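{- Let $G$ be a finite simple graph, $k$ a positive integer, and $\{P_1,P_2,P_3\}$ a $T$-triangle in $\mathcal{B}_k(G)$ whose edges are realized by distinct vertices $v_1,v_2,v_3$ ($P_1-v_3=P_2-v_3$, $P_2-v_1=P_3-v_1$, $P_3-v_2=P_1-v_2$). Let $W=V(G)\setminus\{v_1,v_2,v_3\}$ and let $R$ be the common restriction $P_1|_W=P_2|_W=P_3|_W$. If $P$ is a vertex of $\mathcal{B}_k(G)$ adjacent to each of $P_1,P_2,P_3$, then $P|_W=R$.
   Context: A stable $k$-partition of $G$ is a multiset $P=\{V_1,\dots,V_k\}$ of $k$ independent sets of $G$ (some possibly empty) partitioning $V(G)$; $P-v$ denotes $\{V_i\setminus\{v\}\}$, and for $W\subseteq V(G)$ the restriction $P|_W$ is the multiset $\{V_i\cap W\}$. The Bell $k$-coloring graph $\mathcal{B}_k(G)$ has vertex set the stable $k$-partitions, with distinct $P,Q$ adjacent iff $P-v=Q-v$ for some $v\in V(G)$. A $T$-triangle is a $3$-clique $\{P_1,P_2,P_3\}$ for which there is no single vertex $u$ with $P_i-u=P_j-u$ for all $i<j$. -}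

module Defs where

open import Data.Nat using (ℕ)
open import Data.Fin using (Fin)
open import Data.Fin.Subset using (Subset; _∈_; _∩_; _∪_; ∁; ⁅_⁆) renaming (_-_ to _∖_)
open import Data.Fin.Permutation using (Permutation′; _⟨$⟩ʳ_)
open import Data.Product using (Σ; ∃; _×_)
open import Relation.Binary.PropositionalEquality using (_≡_)
open import Relation.Nullary using (¬_)

record Graph (n : ℕ) : Set₁ where
  field
    Adj     : Fin n → Fin n → Set
    sym     : ∀ {u v} → Adj u v → Adj v u
    irrefl  : ∀ {u} → ¬ Adj u u

-- A k-tuple of subsets of V(G); a multiset of k subsets is such a tuple
-- considered up to permutation of the indices (see _≈ₘ_).
Tuple : ℕ → ℕ → Set
Tuple n k = Fin k → Subset n

_≈ₘ_ : ∀ {n k} → Tuple n k → Tuple n k → Set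
_≈ₘ_ {n} {k} A B = Σ (Permutation′ k) λ σ → ∀ i → A i ≡ B (σ ⟨$⟩ʳ i)

_−_ : ∀ {n k} → Tuple n k → Fin n → Tuple n k
(P − v) i = P i ∖ v

_∣_ : ∀ {n k} → Tuple n k → Subset n → Tuple n k
(P ∣ W) i = P i ∩ W

record IsStablePartition {n : ℕ} (G : Graph n) (k : ℕ) (P : Tuple n k) : Set where
  open Graph G
  field
    independent : ∀ i u v → u ∈ P i → v ∈ P i → ¬ Adj u v
    covers      : ∀ u → ∃ λ i → u ∈ P i
    disjoint    : ∀ i j u → u ∈ P i → u ∈ P j → i ≡ j

-- Vertices of B_k(G) (as representatives; equality is _≈ₘ_).
record StablePartition {n : ℕ} (G : Graph n) (k : ℕ) : Set where
  field
    parts  : Tuple n k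
    stable : IsStablePartition G k parts
open StablePartition public

BAdj : ∀ {n} {G : Graph n} {k} → StablePartition G k → StablePartition G k → Set
BAdj {n} P Q = ¬ (parts P ≈ₘ parts Q) × ∃ λ (v : Fin n) → (parts P − v) ≈ₘ (parts Q − v)

IsTTriangle : ∀ {n} {G : Graph n} {k} → (P₁ P₂ P₃ : StablePartition G k) → Set
IsTTriangle {n} P₁ P₂ P₃ =
  BAdj P₁ P₂ × BAdj P₂ P₃ × BAdj P₁ P₃ ×
  ¬ (∃ λ (u : Fin n) →
       ((parts P₁ − u) ≈ₘ (parts P₂ − u)) ×
       ((parts P₁ − u) ≈ₘ (parts P₃ − u)) ×
       ((parts P₂ − u) ≈ₘ (parts P₃ − u)))

without3 : ∀ {n} → Fin n → Fin n → Fin n → Subset n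
without3 v₁ v₂ v₃ = ∁ (⁅ v₁ ⁆ ∪ (⁅ v₂ ⁆ ∪ ⁅ v₃ ⁆))

-- If P is adjacent to P₁ through a vertex a ∉ W, then P|W = P₁|W = R, and
-- likewise for P₂ through a vertex b. Otherwise a, b ∈ W and P₁ = P₂,
-- contradicting their adjacency: as P₁ − v₃ = P₂ − v₃, it suffices that a
-- vertex x shares the block of v₃ in P₁ iff it does in P₂. For x ∈ {v₁, v₂}
-- this passes through P, which agrees with P₁ and P₂ away from a and b; for
-- every other x it passes through P₃, via P₁ − v₂ = P₃ − v₂ and
-- P₃ − v₁ = P₂ − v₁.
module Submission where

open import Defs
open import Data.Nat using (ℕ; _≤_)
open import Data.Fin using (Fin; _≟_)
open import Data.Empty using (⊥-elim)
open import Data.Fin.Subset using (Subset; _∈_; _∉_; _∩_; ⁅_⁆) renaming (_-_ to _∖_)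
open import Data.Fin.Subset.Properties
  using (⊆-antisym; p─q⊆p; x∈p∧x≢y⇒x∈p-y; x∈p∩q⁺; x∈p∩q⁻; x∈∁p⇒x∉p; x∈p∪q⁺; x∈⁅x⁆; _∈?_)
open import Data.Fin.Permutation using (_⟨$⟩ʳ_; _⟨$⟩ˡ_; inverseʳ; flip; _∘ₚ_; transpose)
import Data.Fin.Permutation.Components as PC
open import Data.Product using (∃; _×_; _,_)
open import Data.Sum using (inj₁; inj₂)
open import Function.Bundles using (_⇔_; mk⇔; Equivalence; Injection)
open import Function.Properties.Equivalence using () renaming (sym to ⇔-sym; trans to ⇔-trans)
open import Function.Properties.Inverse using (↔⇒↣)
open import Relation.Binary.PropositionalEquality
  using (_≡_; _≢_; refl; sym; trans; cong; subst; ≢-sym; module ≡-Reasoning)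
open import Relation.Nullary using (yes; no)
open import Relation.Nullary.Decidable using (dec-true; dec-false)

open Equivalence using (to; from)

private
  variable
    n k : ℕ

x∉p⇒p-x≡p : {p : Subset n} {x : Fin n} → x ∉ p → p ∖ x ≡ p
x∉p⇒p-x≡p {p = p} {x} x∉p =
  ⊆-antisym (p─q⊆p p ⁅ x ⁆) (λ y∈p → x∈p∧x≢y⇒x∈p-y y∈p λ { refl → x∉p y∈p })

p-x∩q≡p∩q : {p q : Subset n} {x : Fin n} → x ∉ q → (p ∖ x) ∩ q ≡ p ∩ q
p-x∩q≡p∩q {p = p} {q} {x} x∉q = ⊆-antisym
  (λ y∈ → let (y∈p-x , y∈q) = x∈p∩q⁻ (p ∖ x) q y∈ in x∈p∩q⁺ (p─q⊆p p ⁅ x ⁆ y∈p-x , y∈q))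
  (λ y∈ → let (y∈p , y∈q) = x∈p∩q⁻ p q y∈ in
    x∈p∩q⁺ (x∈p∧x≢y⇒x∈p-y y∈p (λ { refl → x∉q y∈q }) , y∈q))

∈-cong-∖ : {p q : Subset n} {x v : Fin n} → p ∖ v ≡ q ∖ v → x ≢ v → x ∈ p → x ∈ q
∈-cong-∖ {q = q} {v = v} p-v≡q-v x≢v x∈p =
  p─q⊆p q ⁅ v ⁆ (subst (_ ∈_) p-v≡q-v (x∈p∧x≢y⇒x∈p-y x∈p x≢v))

∈-without3⁻ : {x v₁ v₂ v₃ : Fin n} → x ∈ without3 v₁ v₂ v₃ → v₁ ≢ x × v₂ ≢ x × v₃ ≢ x
∈-without3⁻ x∈W =
    (λ { refl → x∈∁p⇒x∉p x∈W (x∈p∪q⁺ (inj₁ (x∈⁅x⁆ _))) })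
  , (λ { refl → x∈∁p⇒x∉p x∈W (x∈p∪q⁺ (inj₂ (x∈p∪q⁺ (inj₁ (x∈⁅x⁆ _))))) })
  , (λ { refl → x∈∁p⇒x∉p x∈W (x∈p∪q⁺ (inj₂ (x∈p∪q⁺ (inj₂ (x∈⁅x⁆ _))))) })

transpose-ˡ : (i j : Fin k) → PC.transpose i j i ≡ j
transpose-ˡ i j rewrite dec-true (i ≟ i) refl = refl

transpose-ʳ : (i j : Fin k) → PC.transpose i j j ≡ i
transpose-ʳ i j with j ≟ i
... | yes j≡i = j≡i
... | no _ rewrite dec-true (j ≟ j) refl = refl

transpose-≢ : (i j l : Fin k) → l ≢ i → l ≢ j → PC.transpose i j l ≡ l
transpose-≢ i j l l≢i l≢j rewrite dec-false (l ≟ i) l≢i | dec-false (l ≟ j) l≢j = refl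

≈ₘ-sym : {A B : Tuple n k} → A ≈ₘ B → B ≈ₘ A
≈ₘ-sym {B = B} (σ , A≡Bσ) = flip σ , λ j → sym (trans (A≡Bσ (σ ⟨$⟩ˡ j)) (cong B (inverseʳ σ)))

≈ₘ-trans : {A B C : Tuple n k} → A ≈ₘ B → B ≈ₘ C → A ≈ₘ C
≈ₘ-trans (σ , A≡Bσ) (τ , B≡Cτ) = σ ∘ₚ τ , λ i → trans (A≡Bσ i) (B≡Cτ (σ ⟨$⟩ʳ i))

−≈ₘ⇒∣≈ₘ : {P Q : Tuple n k} {a : Fin n} {W : Subset n} →
          a ∉ W → (P − a) ≈ₘ (Q − a) → (P ∣ W) ≈ₘ (Q ∣ W)
−≈ₘ⇒∣≈ₘ {P = P} {Q} {a} {W} a∉W (σ , P−a≡Q−aσ) = σ , λ i → begin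
  P i ∩ W                 ≡⟨ p-x∩q≡p∩q a∉W ⟨
  (P i ∖ a) ∩ W           ≡⟨ cong (_∩ W) (P−a≡Q−aσ i) ⟩
  (Q (σ ⟨$⟩ʳ i) ∖ a) ∩ W  ≡⟨ p-x∩q≡p∩q a∉W ⟩
  Q (σ ⟨$⟩ʳ i) ∩ W        ∎
  where open ≡-Reasoning

-- σ sends the block i₀ of v in A to some σ i₀, not necessarily to the block
-- j₀ of v in B; composing with the transposition of σ i₀ and j₀ repairs this.
−≈ₘ⇒≈ₘ : {A B : Tuple n k} {v : Fin n} {i₀ j₀ : Fin k} →
         (∀ i → i ≢ i₀ → v ∉ A i) → (∀ j → j ≢ j₀ → v ∉ B j) → A i₀ ≡ B j₀ →
         (A − v) ≈ₘ (B − v) → A ≈ₘ B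
−≈ₘ⇒≈ₘ {k = k} {A = A} {B} {v} {i₀} {j₀} v∉A v∉B A₀≡B₀ (σ , A−v≡B−vσ) =
  σ ∘ₚ transpose j₁ j₀ , match
  where
  open ≡-Reasoning
  j₁ : Fin k
  j₁ = σ ⟨$⟩ʳ i₀

  σi≢j₁ : ∀ {i} → i ≢ i₀ → σ ⟨$⟩ʳ i ≢ j₁
  σi≢j₁ i≢i₀ σi≡j₁ = i≢i₀ (Injection.injective (↔⇒↣ σ) σi≡j₁)

  match : ∀ i → A i ≡ B (PC.transpose j₁ j₀ (σ ⟨$⟩ʳ i))
  match i with i ≟ i₀
  ... | yes refl = trans A₀≡B₀ (cong B (sym (transpose-ˡ j₁ j₀)))
  ... | no i≢i₀ with σ ⟨$⟩ʳ i ≟ j₀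
  ...   | no σi≢j₀ = begin
    A i                                ≡⟨ x∉p⇒p-x≡p (v∉A i i≢i₀) ⟨
    A i ∖ v                            ≡⟨ A−v≡B−vσ i ⟩
    B (σ ⟨$⟩ʳ i) ∖ v                   ≡⟨ x∉p⇒p-x≡p (v∉B _ σi≢j₀) ⟩
    B (σ ⟨$⟩ʳ i)                       ≡⟨ cong B (transpose-≢ j₁ j₀ _ (σi≢j₁ i≢i₀) σi≢j₀) ⟨
    B (PC.transpose j₁ j₀ (σ ⟨$⟩ʳ i))  ∎
  ...   | yes σi≡j₀ = begin
    A i                                ≡⟨ x∉p⇒p-x≡p (v∉A i i≢i₀) ⟨
    A i ∖ v                            ≡⟨ A−v≡B−vσ i ⟩
    B (σ ⟨$⟩ʳ i) ∖ v                   ≡⟨ cong (λ j → B j ∖ v) σi≡j₀ ⟩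
    B j₀ ∖ v                           ≡⟨ cong (_∖ v) A₀≡B₀ ⟨
    A i₀ ∖ v                           ≡⟨ A−v≡B−vσ i₀ ⟩
    B j₁ ∖ v                           ≡⟨ x∉p⇒p-x≡p (v∉B j₁ (λ j₁≡j₀ → σi≢j₁ i≢i₀ (trans σi≡j₀ (sym j₁≡j₀)))) ⟩
    B j₁                               ≡⟨ cong B (transpose-ʳ j₁ j₀) ⟨
    B (PC.transpose j₁ j₀ j₀)          ≡⟨ cong (λ j → B (PC.transpose j₁ j₀ j)) σi≡j₀ ⟨
    B (PC.transpose j₁ j₀ (σ ⟨$⟩ʳ i))  ∎

SameBlock : Tuple n k → Fin n → Fin n → Set
SameBlock P x y = ∃ λ i → x ∈ P i × y ∈ P i

−≈ₘ⇒SameBlock : {P Q : Tuple n k} {v x y : Fin n} →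
                (P − v) ≈ₘ (Q − v) → x ≢ v → y ≢ v → SameBlock P x y → SameBlock Q x y
−≈ₘ⇒SameBlock (σ , P−v≡Q−vσ) x≢v y≢v (i , x∈Pi , y∈Pi) =
  σ ⟨$⟩ʳ i , ∈-cong-∖ (P−v≡Q−vσ i) x≢v x∈Pi , ∈-cong-∖ (P−v≡Q−vσ i) y≢v y∈Pi

−≈ₘ⇒SameBlock⇔ : {P Q : Tuple n k} {v x y : Fin n} →
                 (P − v) ≈ₘ (Q − v) → x ≢ v → y ≢ v → SameBlock P x y ⇔ SameBlock Q x y
−≈ₘ⇒SameBlock⇔ P≈Q x≢v y≢v =
  mk⇔ (−≈ₘ⇒SameBlock P≈Q x≢v y≢v) (−≈ₘ⇒SameBlock (≈ₘ-sym P≈Q) x≢v y≢v)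

module _ {G : Graph n} {P : Tuple n k} (P-stable : IsStablePartition G k P) where
  open IsStablePartition P-stable

  ∈⇔SameBlock : {v x : Fin n} {i : Fin k} → v ∈ P i → x ∈ P i ⇔ SameBlock P x v
  ∈⇔SameBlock {i = i} v∈Pi = mk⇔
    (λ x∈Pi → i , x∈Pi , v∈Pi)
    (λ (j , x∈Pj , v∈Pj) → subst (λ j → _ ∈ P j) (disjoint j i _ v∈Pj v∈Pi) x∈Pj)

  ∉-other-blocks : {v : Fin n} {i : Fin k} → v ∈ P i → ∀ j → j ≢ i → v ∉ P j
  ∉-other-blocks {i = i} v∈Pi j j≢i v∈Pj = j≢i (disjoint j i _ v∈Pj v∈Pi)

SameBlock⇔⇒≈ₘ : {G : Graph n} {P Q : Tuple n k} {v : Fin n} →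
                IsStablePartition G k P → IsStablePartition G k Q →
                (P − v) ≈ₘ (Q − v) → (∀ x → SameBlock P x v ⇔ SameBlock Q x v) → P ≈ₘ Q
SameBlock⇔⇒≈ₘ {P = P} {Q} {v} P-stable Q-stable P≈Q sameBlock
  with IsStablePartition.covers P-stable v | IsStablePartition.covers Q-stable v
... | i₀ , v∈Pi₀ | j₀ , v∈Qj₀ =
  −≈ₘ⇒≈ₘ (∉-other-blocks P-stable v∈Pi₀) (∉-other-blocks Q-stable v∈Qj₀) Pi₀≡Qj₀ P≈Q
  where
  blocks⇔ : ∀ x → x ∈ P i₀ ⇔ x ∈ Q j₀
  blocks⇔ x = ⇔-trans (∈⇔SameBlock P-stable v∈Pi₀)
                (⇔-trans (sameBlock x) (⇔-sym (∈⇔SameBlock Q-stable v∈Qj₀)))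

  Pi₀≡Qj₀ : P i₀ ≡ Q j₀
  Pi₀≡Qj₀ = ⊆-antisym (λ {x} → to (blocks⇔ x)) (λ {x} → from (blocks⇔ x))

lemma3p7 : {n : ℕ} (G : Graph n) (k : ℕ) → 1 ≤ k →
    (P₁ P₂ P₃ : StablePartition G k) → IsTTriangle P₁ P₂ P₃ →
    (v₁ v₂ v₃ : Fin n) → v₁ ≢ v₂ → v₂ ≢ v₃ → v₁ ≢ v₃ →
    (parts P₁ − v₃) ≈ₘ (parts P₂ − v₃) →
    (parts P₂ − v₁) ≈ₘ (parts P₃ − v₁) →
    (parts P₃ − v₂) ≈ₘ (parts P₁ − v₂) →
    (R : Tuple n k) →
    (parts P₁ ∣ without3 v₁ v₂ v₃) ≈ₘ R →
    (parts P₂ ∣ without3 v₁ v₂ v₃) ≈ₘ R →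
    (parts P₃ ∣ without3 v₁ v₂ v₃) ≈ₘ R →
    (P : StablePartition G k) → BAdj P P₁ → BAdj P P₂ → BAdj P P₃ →
    (parts P ∣ without3 v₁ v₂ v₃) ≈ₘ R
lemma3p7 G k _ P₁ P₂ P₃ ((P₁≉P₂ , _) , _) v₁ v₂ v₃ _ v₂≢v₃ v₁≢v₃ P₁≈P₂ P₂≈P₃ P₃≈P₁
         R P₁∣W≈R P₂∣W≈R _ P (_ , a , P≈P₁) (_ , b , P≈P₂) _
  with a ∈? without3 v₁ v₂ v₃ | b ∈? without3 v₁ v₂ v₃
... | no a∉W | _ = ≈ₘ-trans {C = R} (−≈ₘ⇒∣≈ₘ {Q = parts P₁} a∉W P≈P₁) P₁∣W≈R
... | yes _ | no b∉W = ≈ₘ-trans {C = R} (−≈ₘ⇒∣≈ₘ {Q = parts P₂} b∉W P≈P₂) P₂∣W≈R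
... | yes a∈W | yes b∈W with ∈-without3⁻ a∈W | ∈-without3⁻ b∈W
...   | v₁≢a , v₂≢a , v₃≢a | v₁≢b , v₂≢b , v₃≢b =
  ⊥-elim (P₁≉P₂ (SameBlock⇔⇒≈ₘ (stable P₁) (stable P₂) P₁≈P₂ sameBlock))
  where
  throughP : ∀ {x} → x ≢ a → x ≢ b → SameBlock (parts P₁) x v₃ ⇔ SameBlock (parts P₂) x v₃
  throughP x≢a x≢b = ⇔-trans (⇔-sym (−≈ₘ⇒SameBlock⇔ P≈P₁ x≢a v₃≢a))
                              (−≈ₘ⇒SameBlock⇔ P≈P₂ x≢b v₃≢b)

  throughP₃ : ∀ {x} → x ≢ v₁ → x ≢ v₂ → SameBlock (parts P₁) x v₃ ⇔ SameBlock (parts P₂) x v₃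
  throughP₃ x≢v₁ x≢v₂ = ⇔-trans (⇔-sym (−≈ₘ⇒SameBlock⇔ P₃≈P₁ x≢v₂ (≢-sym v₂≢v₃)))
                                 (⇔-sym (−≈ₘ⇒SameBlock⇔ P₂≈P₃ x≢v₁ (≢-sym v₁≢v₃)))

  sameBlock : ∀ x → SameBlock (parts P₁) x v₃ ⇔ SameBlock (parts P₂) x v₃
  sameBlock x with x ≟ v₁ | x ≟ v₂
  ... | yes refl | _        = throughP v₁≢a v₁≢b
  ... | no _     | yes refl = throughP v₂≢a v₂≢b
  ... | no x≢v₁  | no x≢v₂  = throughP₃ x≢v₁ x≢v₂
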